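{- Let $G=(X\cup Y,E)$ be a connected convex bipartite graph with a lex-convex ordering $\sigma=(x_1,\ldots,x_{n_1},y_1,\ldots,y_{n_2})$. Let $x_r=right(y_1)$, $y_s=right(x_r)$, $x_l=left(y_{s+1})$, and for $y_\alpha\in N_G(x_1)$ let $x_{k_\alpha}=right(y_\alpha)$ and $y_{l_\alpha}=left(x_{k_\alpha+1})$. Then one of the following holds: (a) $\gamma_{ve}(G)=\gamma_{ve}(G')+1$, where $G'=G[\{x_l,\ldots,x_{n_1}\}\cup\{y_{s+1},\ldots,y_{n_2}\}]$; (b) $\gamma_{ve}(G)=\gamma_{ve}(\widetilde G)+1$, where $\widetilde G=G[\{x_{k_\alpha+1},\ldots,x_{n_1}\}\cup\{y_{l_\alpha},\ldots,y_{n_2}\}]$ for some $y_\alpha\in N_G(x_1)$.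
   Context: All graphs are finite, simple, undirected; $G[W]$ is the subgraph induced by $W$. $N_G(v)$ is the neighbourhood of $v$, $N_G[v]=N_G(v)\cup\{v\}$. A set $D\subseteq V(G)$ is a vertex-edge dominating set (VED-set) if for every edge $uv$, $|(N_G[u]\cup N_G[v])\cap D|\ge 1$; $\gamma_{ve}(G)$ is the minimum size of a VED-set. A bipartite graph $G=(X\cup Y,E)$ is convex if $Y$ can be ordered so that every $x\in X$ has consecutive neighbours in $Y$. Given an ordering $\sigma=(x_1,\ldots,x_{n_1},y_1,\ldots,y_{n_2})$, for a vertex $v$, $left(v)$ (resp. $right(v)$) denotes the neighbour of $v$ of minimum (resp. maximum) index in $\sigma$; $\prec,\preceq$ compare indices. The ordering $\sigma$ is lex-convex if the ordering of $Y$ is convex and for all $i<j$ either $left(x_i)\prec left(x_j)$, or $left(x_i)=left(x_j)$ and $right(x_i)\preceq right(x_j)$. -}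

module Defs where

open import Data.Nat using (ℕ; zero; suc; _+_) renaming (_≤_ to _≤ℕ_)
open import Data.Fin using (Fin; toℕ; _≤_; _<_)
open import Data.Fin.Subset using (Subset; _∈_; ∣_∣)
open import Data.Bool using (Bool; true)
open import Data.Sum using (_⊎_; inj₁; inj₂)
open import Data.Product using (Σ; _×_; ∃-syntax)
open import Data.Empty using (⊥)
open import Relation.Binary.PropositionalEquality using (_≡_)
open import Relation.Binary.Construct.Closure.ReflexiveTransitive using (Star)

-- A bipartite graph G = (X ∪ Y, E) with X = {x_0,…,x_{m-1}} = Fin m and
-- Y = {y_0,…,y_{n-1}} = Fin n (0-based indices; the paper's x_1 is 'zero'),
-- given by its bipartite adjacency  adj x y ≡ true  iff  xy ∈ E.
-- The ordering σ = (x_1..x_m, y_1..y_n) is the natural order of Fin.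

module _ {m n : ℕ} (adj : Fin m → Fin n → Bool) where

  Edge : Fin m ⊎ Fin n → Fin m ⊎ Fin n → Set
  Edge (inj₁ x) (inj₂ y) = adj x y ≡ true
  Edge (inj₂ y) (inj₁ x) = adj x y ≡ true
  Edge _        _        = ⊥

  Connected : Set
  Connected = ∀ u v → Star Edge u v

  IsLeftX : Fin m → Fin n → Set
  IsLeftX x y = adj x y ≡ true × (∀ y' → adj x y' ≡ true → y ≤ y')

  IsRightX : Fin m → Fin n → Set
  IsRightX x y = adj x y ≡ true × (∀ y' → adj x y' ≡ true → y' ≤ y)

  IsLeftY : Fin n → Fin m → Set
  IsLeftY y x = adj x y ≡ true × (∀ x' → adj x' y ≡ true → x ≤ x')

  IsRightY : Fin n → Fin m → Set
  IsRightY y x = adj x y ≡ true × (∀ x' → adj x' y ≡ true → x' ≤ x)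

  Convex : Set
  Convex = ∀ x (y₁ y₂ y₃ : Fin n) → y₁ ≤ y₂ → y₂ ≤ y₃ →
           adj x y₁ ≡ true → adj x y₃ ≡ true → adj x y₂ ≡ true

  LexConvex : Set
  LexConvex = Convex ×
    (∀ (i j : Fin m) (li lj ri rj : Fin n) → i < j →
       IsLeftX i li → IsLeftX j lj → IsRightX i ri → IsRightX j rj →
       li < lj ⊎ (li ≡ lj × ri ≤ rj))

  -- Induced subgraph G[W] with W = WX ∪ WY (WX ⊆ X, WY ⊆ Y).
  -- D = DX ∪ DY is a VED-set of G[W]: D ⊆ W and every edge xy of G[W]
  -- has (N[x] ∪ N[y]) ∩ D ≠ ∅, neighbourhoods taken in G[W].
  IsVED : (WX : Fin m → Set) (WY : Fin n → Set) → Subset m → Subset n → Set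
  IsVED WX WY DX DY =
    (∀ x → x ∈ DX → WX x) × (∀ y → y ∈ DY → WY y) ×
    (∀ x y → WX x → WY y → adj x y ≡ true →
       (x ∈ DX) ⊎ (y ∈ DY)
       ⊎ (∃[ y' ] (y' ∈ DY × WY y' × adj x y' ≡ true))
       ⊎ (∃[ x' ] (x' ∈ DX × WX x' × adj x' y ≡ true)))

  GammaVE : (WX : Fin m → Set) (WY : Fin n → Set) → ℕ → Set
  GammaVE WX WY k =
    (∃[ DX ] ∃[ DY ] (IsVED WX WY DX DY × ∣ DX ∣ + ∣ DY ∣ ≡ k)) ×
    (∀ DX DY → IsVED WX WY DX DY → k ≤ℕ ∣ DX ∣ + ∣ DY ∣)

  GammaPlusOne : (WX : Fin m → Set) (WY : Fin n → Set)
                 (WX' : Fin m → Set) (WY' : Fin n → Set) → Set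
  GammaPlusOne WX WY WX' WY' =
    Σ ℕ λ k → GammaVE WX WY (suc k) × GammaVE WX' WY' k

-- Write x₀, y₀ for the first vertices (the paper's x₁, y₁). Lex-convexity forces every x ≤ xr
-- to have left(x) = y₀ and right(x) ≤ ys, while xr is adjacent to all of y₀ … ys. Hence adding xr
-- to a VED-set of G′, or adding yα to a VED-set of G̃ when yα is adjacent to all of x₀ … kα, gives
-- a VED-set of G, so γ(G) ≤ γ(G′) + 1 and γ(G) ≤ γ(G̃) + 1. Conversely a minimum VED-set D of G
-- must dominate the edge x₀y₀, so it contains a vertex x < xl or a neighbour y₁ ≤ ys of x₀. If it
-- contains such an x, or two vertices y ≤ ys, its part inside G′, with y_{s+1} added if needed, is
-- a smaller VED-set of G′ (when ys is the last vertex, G′ has no edges and {xr} dominates G).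
-- Otherwise y₁ is its only vertex y ≤ ys. If some x ∈ D has left(x) ≤ y₁, trade x for a
-- neighbour of y₁ reaching furthest to the right and drop y₁: this is a smaller VED-set of G′. If
-- not, D \ {y₁} is a smaller VED-set of G̃ for yα = y₁, and D forces yα to be adjacent to all of
-- x₀ … kα.
module Submission where

open import Data.Bool using (Bool; true; false)
open import Data.Bool.Properties using () renaming (_≟_ to _≟ᵇ_)
open import Data.Empty using (⊥-elim)
open import Data.Fin using (Fin; zero; suc; toℕ; fromℕ<; _≤_; _<_)
open import Data.Fin.Properties using (any?; all?; _≤?_; _<?_; _≟_; toℕ-injective; toℕ<n; toℕ-fromℕ<)
open import Data.Fin.Subset using (Subset; _∈_; _∉_; _⊆_; _∪_; _∩_; _-_; ⁅_⁆; ∣_∣) renaming (⊥ to ∅)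
open import Data.Fin.Subset.Properties
  using (_∈?_; anySubset?; ∉⊥; ∣⊥∣≡0; x∈⁅x⁆; x∈⁅y⁆⇒x≡y; ∣⁅x⁆∣≡1; p⊂q⇒∣p∣<∣q∣; p∩q⊆p; ∣p∩q∣≤∣p∣;
         x∈p∩q⁺; x∈p∩q⁻; x∈p∪q⁺; x∈p∪q⁻; x∈p∧x≢y⇒x∈p-y; x∈p⇒∣p-x∣<∣p∣)
open import Data.Nat as ℕ using (ℕ; zero; suc; z≤n; s≤s; _+_)
open import Data.Nat.Properties
  using (≤-refl; ≤-reflexive; ≤-trans; ≤-antisym; <⇒≤; <⇒≱; ≰⇒>; ≮⇒≥; <-irrefl; n≤1+n; n≤0⇒n≡0; m≤m+n; m≤n+m;
         n≮0; 1+n≰n; ≤-pred; m≤n⇒m<n∨m≡n; +-suc; +-comm; +-monoˡ-≤; +-monoʳ-≤; +-mono-≤; +-mono-≤-<)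
open import Data.Product using (∃; ∃-syntax; _×_; _,_; proj₁; proj₂; uncurry)
open import Data.Sum using (_⊎_; inj₁; inj₂)
open import Data.Unit using (⊤; tt)
open import Data.Vec using (_∷_; []; tabulate)
open import Data.Vec.Properties using (lookup∘tabulate; lookup⇒[]=; []=⇒lookup)
open import Function using (_∘_; case_of_)
open import Relation.Binary.Construct.Closure.ReflexiveTransitive using (_◅_)
open import Relation.Binary.PropositionalEquality using (_≡_; _≢_; refl; sym; trans; cong; cong₂; subst)
open import Relation.Nullary using (Dec; yes; no; ¬_; does; ¬?; _×-dec_; _⊎-dec_; _→-dec_)
open import Relation.Nullary.Decidable using (dec-true; map′; decidable-stable)
open import Relation.Unary using (Decidable)
open import Defs

select : ∀ {n} {P : Fin n → Set} → Decidable P → Subset n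
select P? = tabulate (does ∘ P?)

∈-select⁺ : ∀ {n} {P : Fin n → Set} (P? : Decidable P) {i} → P i → i ∈ select P?
∈-select⁺ P? {i} p = lookup⇒[]= i _ (trans (lookup∘tabulate (does ∘ P?) i) (dec-true (P? i) p))

∈-select⁻ : ∀ {n} {P : Fin n → Set} (P? : Decidable P) {i} → i ∈ select P? → P i
∈-select⁻ P? {i} i∈ with P? i | trans (sym (lookup∘tabulate (does ∘ P?) i)) ([]=⇒lookup i∈)
... | yes p | _ = p

atLeast above : ∀ {n} → Fin n → Subset n
atLeast i = select (i ≤?_)
above i = select (i <?_)

∉atLeast : ∀ {n} {i j : Fin n} → j < i → j ∉ atLeast i
∉atLeast j<i j∈ = <⇒≱ j<i (∈-select⁻ (_ ≤?_) j∈)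

∉above : ∀ {n} {i j : Fin n} → j ≤ i → j ∉ above i
∉above j≤i j∈ = <⇒≱ (∈-select⁻ (_ <?_) j∈) j≤i

∣p∪q∣≤∣p∣+∣q∣ : ∀ {n} (p q : Subset n) → ∣ p ∪ q ∣ ℕ.≤ ∣ p ∣ + ∣ q ∣
∣p∪q∣≤∣p∣+∣q∣ []          []          = z≤n
∣p∪q∣≤∣p∣+∣q∣ (true ∷ p)  (true ∷ q)  =
  s≤s (≤-trans (∣p∪q∣≤∣p∣+∣q∣ p q) (+-monoʳ-≤ ∣ p ∣ (n≤1+n ∣ q ∣)))
∣p∪q∣≤∣p∣+∣q∣ (true ∷ p)  (false ∷ q) = s≤s (∣p∪q∣≤∣p∣+∣q∣ p q)
∣p∪q∣≤∣p∣+∣q∣ (false ∷ p) (true ∷ q)  =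
  ≤-trans (s≤s (∣p∪q∣≤∣p∣+∣q∣ p q)) (≤-reflexive (sym (+-suc ∣ p ∣ ∣ q ∣)))
∣p∪q∣≤∣p∣+∣q∣ (false ∷ p) (false ∷ q) = ∣p∪q∣≤∣p∣+∣q∣ p q

∣p∪⁅x⁆∣≤1+∣p∣ : ∀ {n} (p : Subset n) x → ∣ p ∪ ⁅ x ⁆ ∣ ℕ.≤ suc ∣ p ∣
∣p∪⁅x⁆∣≤1+∣p∣ p x =
  ≤-trans (∣p∪q∣≤∣p∣+∣q∣ p ⁅ x ⁆) (≤-reflexive (trans (cong (∣ p ∣ +_) (∣⁅x⁆∣≡1 x)) (+-comm ∣ p ∣ 1)))

∣p∩q∣<∣p∣ : ∀ {n} {p q : Subset n} {x} → x ∈ p → x ∉ q → ∣ p ∩ q ∣ ℕ.< ∣ p ∣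
∣p∩q∣<∣p∣ {p = p} {q} x∈p x∉q = p⊂q⇒∣p∣<∣q∣ (p∩q⊆p p q , _ , x∈p , x∉q ∘ proj₂ ∘ x∈p∩q⁻ p q)

∣p∩q∣+2≤∣p∣ : ∀ {n} {p q : Subset n} {x y} → x ∈ p → y ∈ p → y ≢ x → x ∉ q → y ∉ q →
              2 + ∣ p ∩ q ∣ ℕ.≤ ∣ p ∣
∣p∩q∣+2≤∣p∣ {p = p} {q} {x} x∈p y∈p y≢x x∉q y∉q =
  ≤-trans (s≤s (p⊂q⇒∣p∣<∣q∣ (p∩q⊆p-x , _ , x∈p∧x≢y⇒x∈p-y y∈p y≢x , y∉q ∘ proj₂ ∘ x∈p∩q⁻ p q)))
          (x∈p⇒∣p-x∣<∣p∣ x∈p)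
  where
  p∩q⊆p-x : p ∩ q ⊆ p - x
  p∩q⊆p-x z∈ with x∈p∩q⁻ p q z∈
  ... | z∈p , z∈q = x∈p∧x≢y⇒x∈p-y z∈p λ { refl → x∉q z∈q }

∈⇒∣p∣≥1 : ∀ {n} {p : Subset n} {x} → x ∈ p → 1 ℕ.≤ ∣ p ∣
∈⇒∣p∣≥1 x∈p = ≤-trans (s≤s z≤n) (x∈p⇒∣p-x∣<∣p∣ x∈p)

∃-least : ∀ {n} {P : Fin n → Set} → Decidable P → ∃ P → ∃ λ i → P i × (∀ j → P j → i ≤ j)
∃-least {suc n} P? (i , pi) with P? zero
... | yes p₀ = zero , p₀ , λ _ _ → z≤n
∃-least {suc n} P? (zero , p₀)  | no ¬p₀ = ⊥-elim (¬p₀ p₀)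
∃-least {suc n} P? (suc i , pi) | no ¬p₀ =
  let j , pj , least = ∃-least (P? ∘ suc) (i , pi)
  in suc j , pj , λ { zero p₀ → ⊥-elim (¬p₀ p₀) ; (suc k) pk → s≤s (least k pk) }

∃-greatest : ∀ {n} {P : Fin n → Set} → Decidable P → ∃ P → ∃ λ i → P i × (∀ j → P j → j ≤ i)
∃-greatest {suc n} P? (i , pi) with any? (P? ∘ suc)
... | yes later =
  let j , pj , greatest = ∃-greatest (P? ∘ suc) later
  in suc j , pj , λ { zero _ → z≤n ; (suc k) pk → s≤s (greatest k pk) }
∃-greatest {suc n} P? (zero , p₀)  | no none =
  zero , p₀ , λ { zero _ → z≤n ; (suc k) pk → ⊥-elim (none (k , pk)) }
∃-greatest {suc n} P? (suc i , pi) | no none = ⊥-elim (none (i , pi))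

next-or-last : ∀ {n} (i : Fin n) → (∃ λ j → toℕ j ≡ suc (toℕ i)) ⊎ (∀ j → ¬ i < j)
next-or-last {n} i with suc (toℕ i) ℕ.<? n
... | yes i+1<n = inj₁ (fromℕ< i+1<n , toℕ-fromℕ< i+1<n)
... | no i+1≮n = inj₂ λ j i<j → i+1≮n (≤-trans (s≤s i<j) (toℕ<n j))

module _ {A : Set} (size : A → ℕ) {P : A → Set}
         (smaller? : ∀ b → Dec (∃ λ a → P a × size a ℕ.< b)) where

  minimal-below : ∀ b a → P a → size a ℕ.≤ b → ∃ λ a → P a × (∀ a' → P a' → size a ℕ.≤ size a')
  minimal-below b a pa a≤b with smaller? (size a)
  ... | no none = a , pa , λ a' pa' → ≮⇒≥ (λ a'<a → none (a' , pa' , a'<a))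
  minimal-below zero    a pa a≤b | yes (a' , pa' , a'<a) = ⊥-elim (n≮0 (≤-trans a'<a a≤b))
  minimal-below (suc b) a pa a≤b | yes (a' , pa' , a'<a) = minimal-below b a' pa' (≤-pred (≤-trans a'<a a≤b))

  minimal : ∀ a → P a → ∃ λ a → P a × (∀ a' → P a' → size a ℕ.≤ size a')
  minimal a pa = minimal-below (size a) a pa ≤-refl

pattern endpoint-x x∈ = inj₁ x∈
pattern endpoint-y y∈ = inj₂ (inj₁ y∈)
pattern neighbour-of-x y' y'∈ y'∈W x~y' = inj₂ (inj₂ (inj₁ (y' , y'∈ , y'∈W , x~y')))
pattern neighbour-of-y x' x'∈ x'∈W x'~y = inj₂ (inj₂ (inj₂ (x' , x'∈ , x'∈W , x'~y)))

Everywhere : ∀ {k} → Fin k → Set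
Everywhere _ = ⊤

module _ {m n : ℕ} (adj : Fin m → Fin n → Bool) where

  Dominated : (Fin m → Set) → (Fin n → Set) → Subset m → Subset n → Fin m → Fin n → Set
  Dominated WX WY DX DY x y =
    (x ∈ DX) ⊎ (y ∈ DY)
    ⊎ (∃[ y' ] (y' ∈ DY × WY y' × adj x y' ≡ true))
    ⊎ (∃[ x' ] (x' ∈ DX × WX x' × adj x' y ≡ true))

  HasVED : (Fin m → Set) → (Fin n → Set) → (ℕ → Set) → Set
  HasVED WX WY Size = ∃[ DX ] ∃[ DY ] (IsVED adj WX WY DX DY × Size (∣ DX ∣ + ∣ DY ∣))

  module _ {WX : Fin m → Set} {WY : Fin n → Set} (WX? : Decidable WX) (WY? : Decidable WY) where

    Dominated? : ∀ DX DY x y → Dec (Dominated WX WY DX DY x y)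
    Dominated? DX DY x y =
      (x ∈? DX) ⊎-dec (y ∈? DY)
      ⊎-dec any? (λ y' → (y' ∈? DY) ×-dec WY? y' ×-dec (adj x y' ≟ᵇ true))
      ⊎-dec any? (λ x' → (x' ∈? DX) ×-dec WX? x' ×-dec (adj x' y ≟ᵇ true))

    IsVED? : ∀ DX DY → Dec (IsVED adj WX WY DX DY)
    IsVED? DX DY =
      all? (λ x → (x ∈? DX) →-dec WX? x) ×-dec
      all? (λ y → (y ∈? DY) →-dec WY? y) ×-dec
      all? (λ x → all? (λ y →
        WX? x →-dec (WY? y →-dec ((adj x y ≟ᵇ true) →-dec Dominated? DX DY x y))))

    γve-exists : ∃ (GammaVE adj WX WY)
    γve-exists with minimal size smaller? (select WX? , select WY?) whole-is-VED
      where
      size : Subset m × Subset n → ℕ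
      size (DX , DY) = ∣ DX ∣ + ∣ DY ∣
      smaller? : ∀ b → Dec (∃ λ D → uncurry (IsVED adj WX WY) D × size D ℕ.< b)
      smaller? b = map′ (λ (DX , DY , h) → (DX , DY) , h) (λ ((DX , DY) , h) → DX , DY , h)
        (anySubset? λ DX → anySubset? λ DY → IsVED? DX DY ×-dec (∣ DX ∣ + ∣ DY ∣ ℕ.<? b))
      whole-is-VED : IsVED adj WX WY (select WX?) (select WY?)
      whole-is-VED = (λ _ → ∈-select⁻ WX?) , (λ _ → ∈-select⁻ WY?) ,
                     λ _ _ wx _ _ → endpoint-x (∈-select⁺ WX? wx)
    ... | (DX , DY) , vD , least = _ , (DX , DY , vD , refl) , λ DX' DY' vD' → least (DX' , DY') vD'

  VED-nonempty : ∀ {WX WY DX DY x y} → WX x → WY y → adj x y ≡ true →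
                 IsVED adj WX WY DX DY → 1 ℕ.≤ ∣ DX ∣ + ∣ DY ∣
  VED-nonempty {DX = DX} {DY} wx wy x~y (_ , _ , dom) with dom _ _ wx wy x~y
  ... | endpoint-x x∈            = ≤-trans (∈⇒∣p∣≥1 x∈) (m≤m+n ∣ DX ∣ ∣ DY ∣)
  ... | endpoint-y y∈            = ≤-trans (∈⇒∣p∣≥1 y∈) (m≤n+m ∣ DY ∣ ∣ DX ∣)
  ... | neighbour-of-x _ y'∈ _ _ = ≤-trans (∈⇒∣p∣≥1 y'∈) (m≤n+m ∣ DY ∣ ∣ DX ∣)
  ... | neighbour-of-y _ x'∈ _ _ = ≤-trans (∈⇒∣p∣≥1 x'∈) (m≤m+n ∣ DX ∣ ∣ DY ∣)

  Dominated-weaken : ∀ {WX WY DX DY DX' DY' x y} → DX ⊆ DX' → DY ⊆ DY' →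
    Dominated WX WY DX DY x y → Dominated Everywhere Everywhere DX' DY' x y
  Dominated-weaken DX⊆ DY⊆ (endpoint-x x∈)              = endpoint-x (DX⊆ x∈)
  Dominated-weaken DX⊆ DY⊆ (endpoint-y y∈)              = endpoint-y (DY⊆ y∈)
  Dominated-weaken DX⊆ DY⊆ (neighbour-of-x y' y'∈ _ e) = neighbour-of-x y' (DY⊆ y'∈) tt e
  Dominated-weaken DX⊆ DY⊆ (neighbour-of-y x' x'∈ _ e) = neighbour-of-y x' (DX⊆ x'∈) tt e

  module _ {WX' : Fin m → Set} {WY' : Fin n → Set} where

    extend-by-x : ∀ x₀ → (∀ x y → adj x y ≡ true → (WX' x × WY' y) ⊎ adj x₀ y ≡ true) →
      ∀ DX DY → IsVED adj WX' WY' DX DY →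
      HasVED Everywhere Everywhere (ℕ._≤ suc (∣ DX ∣ + ∣ DY ∣))
    extend-by-x x₀ split DX DY (_ , _ , dom) =
      DX ∪ ⁅ x₀ ⁆ , DY , ((λ _ _ → tt) , (λ _ _ → tt) , dom′) ,
      +-monoˡ-≤ ∣ DY ∣ (∣p∪⁅x⁆∣≤1+∣p∣ DX x₀)
      where
      dom′ : ∀ x y → ⊤ → ⊤ → adj x y ≡ true → Dominated Everywhere Everywhere (DX ∪ ⁅ x₀ ⁆) DY x y
      dom′ x y _ _ x~y with split x y x~y
      ... | inj₁ (wx , wy) = Dominated-weaken (λ x∈ → x∈p∪q⁺ (inj₁ x∈)) (λ y∈ → y∈) (dom x y wx wy x~y)
      ... | inj₂ x₀~y      = neighbour-of-y x₀ (x∈p∪q⁺ (inj₂ (x∈⁅x⁆ x₀))) tt x₀~y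

    extend-by-y : ∀ y₀ → (∀ x y → adj x y ≡ true → (WX' x × WY' y) ⊎ adj x y₀ ≡ true) →
      ∀ DX DY → IsVED adj WX' WY' DX DY →
      HasVED Everywhere Everywhere (ℕ._≤ suc (∣ DX ∣ + ∣ DY ∣))
    extend-by-y y₀ split DX DY (_ , _ , dom) =
      DX , DY ∪ ⁅ y₀ ⁆ , ((λ _ _ → tt) , (λ _ _ → tt) , dom′) ,
      ≤-trans (+-monoʳ-≤ ∣ DX ∣ (∣p∪⁅x⁆∣≤1+∣p∣ DY y₀)) (≤-reflexive (+-suc ∣ DX ∣ ∣ DY ∣))
      where
      dom′ : ∀ x y → ⊤ → ⊤ → adj x y ≡ true → Dominated Everywhere Everywhere DX (DY ∪ ⁅ y₀ ⁆) x y
      dom′ x y _ _ x~y with split x y x~y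
      ... | inj₁ (wx , wy) = Dominated-weaken (λ x∈ → x∈) (λ y∈ → x∈p∪q⁺ (inj₁ y∈)) (dom x y wx wy x~y)
      ... | inj₂ x~y₀      = neighbour-of-x y₀ (x∈p∪q⁺ (inj₂ (x∈⁅x⁆ y₀))) tt x~y₀

  γve+1-intro : ∀ {WX WY WX' WY' g} → Decidable WX' → Decidable WY' →
    (∀ DX DY → IsVED adj WX' WY' DX DY → HasVED WX WY (ℕ._≤ suc (∣ DX ∣ + ∣ DY ∣))) →
    GammaVE adj WX WY g → HasVED WX' WY' (ℕ._< g) → GammaPlusOne adj WX WY WX' WY'
  γve+1-intro {WX} {WY} {g = g} WX'? WY'? extend γ@(_ , γ-least) (FX , FY , vF , F<g)
    with γve-exists WX'? WY'?
  ... | k , γ′@((DX , DY , vD , D≡k) , γ′-least) = k , subst (GammaVE adj WX WY) g≡1+k γ , γ′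
    where
    g≡1+k : g ≡ suc k
    g≡1+k with extend DX DY vD
    ... | EX , EY , vE , E≤ =
      ≤-antisym (≤-trans (γ-least EX EY vE) (≤-trans E≤ (s≤s (≤-reflexive D≡k))))
                (≤-trans (s≤s (γ′-least FX FY vF)) F<g)

module LexConvexGraph {n₁ n₂ : ℕ} (adj : Fin (suc n₁) → Fin (suc n₂) → Bool)
                      (connected : Connected adj) (lex-convex : LexConvex adj) where

  _~_ : Fin (suc n₁) → Fin (suc n₂) → Set
  x ~ y = adj x y ≡ true

  _~?_ : ∀ x y → Dec (x ~ y)
  x ~? y = adj x y ≟ᵇ true

  IsLeftOfSuccX : Fin (suc n₁) → Fin (suc n₂) → Set
  IsLeftOfSuccX k l = ∀ x' → toℕ x' ≡ suc (toℕ k) → IsLeftX adj x' l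

  IsLeftOfSuccY : Fin (suc n₂) → Fin (suc n₁) → Set
  IsLeftOfSuccY k l = ∀ y' → toℕ y' ≡ suc (toℕ k) → IsLeftY adj y' l

  convex : Convex adj
  convex = proj₁ lex-convex

  has-neighbour : ∀ x → ∃ (x ~_)
  has-neighbour x with connected (inj₁ x) (inj₂ zero)
  ... | _◅_ {j = inj₂ y} x~y _ = y , x~y

  leftX-exists : ∀ x → ∃ (IsLeftX adj x)
  leftX-exists x = ∃-least (x ~?_) (has-neighbour x)

  rightX-exists : ∀ x → ∃ (IsRightX adj x)
  rightX-exists x = ∃-greatest (x ~?_) (has-neighbour x)

  left right : Fin (suc n₁) → Fin (suc n₂)
  left x = proj₁ (leftX-exists x)
  right x = proj₁ (rightX-exists x)

  left-adj : ∀ x → x ~ left x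
  left-adj x = proj₁ (proj₂ (leftX-exists x))

  right-adj : ∀ x → x ~ right x
  right-adj x = proj₁ (proj₂ (rightX-exists x))

  left-min : ∀ {x y} → x ~ y → left x ≤ y
  left-min {x} = proj₂ (proj₂ (leftX-exists x)) _

  right-max : ∀ {x y} → x ~ y → y ≤ right x
  right-max {x} = proj₂ (proj₂ (rightX-exists x)) _

  adj-between : ∀ {x y} → left x ≤ y → y ≤ right x → x ~ y
  adj-between {x} {y} l≤y y≤r = convex x (left x) y (right x) l≤y y≤r (left-adj x) (right-adj x)

  left-right-order : ∀ {i j} → i ≤ j → left i < left j ⊎ (left i ≡ left j × right i ≤ right j)
  left-right-order {i} {j} i≤j with m≤n⇒m<n∨m≡n i≤j
  ... | inj₁ i<j = proj₂ lex-convex i j _ _ _ _ i<j (proj₂ (leftX-exists i)) (proj₂ (leftX-exists j))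
                                                   (proj₂ (rightX-exists i)) (proj₂ (rightX-exists j))
  ... | inj₂ i≡j rewrite toℕ-injective i≡j = inj₂ (refl , ≤-refl)

  left-mono : ∀ {i j} → i ≤ j → left i ≤ left j
  left-mono i≤j with left-right-order i≤j
  ... | inj₁ l<l = <⇒≤ l<l
  ... | inj₂ (l≡l , _) = ≤-reflexive (cong toℕ l≡l)

  right-mono : ∀ {i j} → i ≤ j → left i ≡ left j → right i ≤ right j
  right-mono i≤j l≡l with left-right-order i≤j
  ... | inj₁ l<l = ⊥-elim (<-irrefl (cong toℕ l≡l) l<l)
  ... | inj₂ (_ , r≤r) = r≤r

  leftX-bound : ∀ {x₀ y₀ x y} → IsLeftX adj x₀ y₀ → x₀ ≤ x → x ~ y → y₀ ≤ y
  leftX-bound {x₀} (_ , y₀-least) x₀≤x x~y =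
    ≤-trans (y₀-least (left x₀) (left-adj x₀)) (≤-trans (left-mono x₀≤x) (left-min x~y))

  leftY-bound : ∀ {y₀ x₀ x y} → IsLeftY adj y₀ x₀ → y₀ ≤ y → x ~ y → x₀ ≤ x
  leftY-bound {y₀} {x₀} {x} {y} (x₀~y₀ , x₀-least) y₀≤y x~y with x₀ ≤? x
  ... | yes x₀≤x = x₀≤x
  ... | no x₀≰x = x₀-least x (convex x (left x) y₀ y l≤y₀ y₀≤y (left-adj x) x~y)
    where
    l≤y₀ : left x ≤ y₀
    l≤y₀ = ≤-trans (left-mono (<⇒≤ (≰⇒> x₀≰x))) (left-min x₀~y₀)

  succ-leftX-bound : ∀ {k l x y} → IsLeftOfSuccX k l → k < x → x ~ y → l ≤ y
  succ-leftX-bound {k} {x = x} l-left k<x x~y with next-or-last k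
  ... | inj₁ (k' , k'≡) = leftX-bound (l-left k' k'≡) (subst (ℕ._≤ toℕ x) (sym k'≡) k<x) x~y
  ... | inj₂ k-last = ⊥-elim (k-last x k<x)

  succ-leftY-bound : ∀ {k l x y} → IsLeftOfSuccY k l → k < y → x ~ y → l ≤ x
  succ-leftY-bound {k} {y = y} l-left k<y x~y with next-or-last k
  ... | inj₁ (k' , k'≡) = leftY-bound (l-left k' k'≡) (subst (ℕ._≤ toℕ y) (sym k'≡) k<y) x~y
  ... | inj₂ k-last = ⊥-elim (k-last y k<y)

  succ-leftX-exists : ∀ k → ∃ (IsLeftOfSuccX k)
  succ-leftX-exists k with next-or-last k
  ... | inj₁ (k' , k'≡) = left k' , λ x' x'≡ →
    subst (λ z → IsLeftX adj z (left k')) (toℕ-injective (trans k'≡ (sym x'≡))) (proj₂ (leftX-exists k'))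
  ... | inj₂ k-last = zero , λ x' x'≡ → ⊥-elim (k-last x' (≤-reflexive (sym x'≡)))

  -- Take h adjacent to y₁ and to the largest vertex adjacent to some neighbour of y₁; N(h) is an
  -- interval.
  farthest-neighbour : ∀ {x₁ y₁} → x₁ ~ y₁ →
    ∃ λ h → h ~ y₁ × (∀ {x y} → x ~ y₁ → x ~ y → y₁ ≤ y → h ~ y)
  farthest-neighbour {x₁} {y₁} x₁~y₁
    with ∃-greatest (λ y → any? λ x → (x ~? y₁) ×-dec (x ~? y)) (y₁ , x₁ , x₁~y₁ , x₁~y₁)
  ... | M , (h , h~y₁ , h~M) , M-greatest =
    h , h~y₁ , λ x~y₁ x~y y₁≤y → convex h y₁ _ M y₁≤y (M-greatest _ (_ , x~y₁ , x~y)) h~y₁ h~M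

  -- Conclusion (b), with the adjacency of yα to x₀ … kα that lets yα extend VED-sets of G̃.
  CaseB : ℕ → Set
  CaseB g = ∃[ yα ] ∃[ kα ] ∃[ lα ]
    (zero ~ yα × IsRightY adj yα kα × IsLeftOfSuccX kα lα × (∀ {x} → x ≤ kα → x ~ yα) ×
     HasVED adj (kα <_) (lα ≤_) (ℕ._< g))

  extend-G̃ : ∀ {yα kα lα} → IsLeftOfSuccX kα lα → (∀ {x} → x ≤ kα → x ~ yα) →
    ∀ DX DY → IsVED adj (kα <_) (lα ≤_) DX DY →
    HasVED adj Everywhere Everywhere (ℕ._≤ suc (∣ DX ∣ + ∣ DY ∣))
  extend-G̃ {yα} {kα} {lα} lα-left covers = extend-by-y adj yα split
    where
    split : ∀ x y → x ~ y → (kα < x × lα ≤ y) ⊎ x ~ yα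
    split x y x~y with x ≤? kα
    ... | yes x≤kα = inj₂ (covers x≤kα)
    ... | no x≰kα = inj₁ (≰⇒> x≰kα , succ-leftX-bound lα-left (≰⇒> x≰kα) x~y)

  module FirstBlock (xr : Fin (suc n₁)) (ys : Fin (suc n₂))
                    (xr-right : IsRightY adj zero xr) (ys-right : IsRightX adj xr ys) where

    x≤xr⇒left≡0 : ∀ {x} → x ≤ xr → left x ≡ zero
    x≤xr⇒left≡0 x≤xr = toℕ-injective (n≤0⇒n≡0 (≤-trans (left-mono x≤xr) (left-min (proj₁ xr-right))))

    x≤xr⇒x~0 : ∀ {x} → x ≤ xr → x ~ zero
    x≤xr⇒x~0 x≤xr = adj-between (≤-reflexive (cong toℕ (x≤xr⇒left≡0 x≤xr))) z≤n

    x≤xr∧x~y⇒y≤ys : ∀ {x y} → x ≤ xr → x ~ y → y ≤ ys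
    x≤xr∧x~y⇒y≤ys x≤xr x~y =
      ≤-trans (right-max x~y)
        (≤-trans (right-mono x≤xr (trans (x≤xr⇒left≡0 x≤xr) (sym (x≤xr⇒left≡0 ≤-refl))))
                 (proj₂ ys-right _ (right-adj xr)))

    y≤ys⇒xr~y : ∀ {y} → y ≤ ys → xr ~ y
    y≤ys⇒xr~y y≤ys = convex xr zero _ ys z≤n y≤ys (proj₁ xr-right) (proj₁ ys-right)

    G′-empty : (∀ y → ¬ ys < y) → ∀ {xl : Fin (suc n₁)} {g} → GammaVE adj Everywhere Everywhere g →
               HasVED adj (xl ≤_) (ys <_) (ℕ._< g)
    G′-empty ys-last ((DX , DY , vD , refl) , _) =
      ∅ , ∅ , ((λ _ → ⊥-elim ∘ ∉⊥) , (λ _ → ⊥-elim ∘ ∉⊥) , λ _ y _ ys<y _ → ⊥-elim (ys-last y ys<y)) ,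
      subst (ℕ._< ∣ DX ∣ + ∣ DY ∣) (sym (cong₂ _+_ (∣⊥∣≡0 (suc n₁)) (∣⊥∣≡0 (suc n₂))))
            (VED-nonempty adj tt tt (x≤xr⇒x~0 {zero} z≤n) vD)

    module _ {xl} (xl-left : IsLeftOfSuccY ys xl) where

      extend-G′ : ∀ DX DY → IsVED adj (xl ≤_) (ys <_) DX DY →
                  HasVED adj Everywhere Everywhere (ℕ._≤ suc (∣ DX ∣ + ∣ DY ∣))
      extend-G′ = extend-by-x adj xr split
        where
        split : ∀ x y → x ~ y → (xl ≤ x × ys < y) ⊎ xr ~ y
        split x y x~y with y ≤? ys
        ... | yes y≤ys = inj₂ (y≤ys⇒xr~y y≤ys)
        ... | no y≰ys = inj₁ (succ-leftY-bound xl-left (≰⇒> y≰ys) x~y , ≰⇒> y≰ys)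

      module _ {ysn : Fin (suc n₂)} (ysn≡ : toℕ ysn ≡ suc (toℕ ys)) where

        ys<ysn : ys < ysn
        ys<ysn = ≤-reflexive (sym ysn≡)

        ys<y⇒ysn≤y : ∀ {y : Fin (suc n₂)} → ys < y → ysn ≤ y
        ys<y⇒ysn≤y {y} = subst (ℕ._≤ toℕ y) (sym ysn≡)

        x≤xr⇒x<xl : ∀ {x : Fin (suc n₁)} → x ≤ xr → x < xl
        x≤xr⇒x<xl x≤xr = ≰⇒> λ xl≤x →
          1+n≰n (subst (ℕ._≤ toℕ ys) ysn≡ (x≤xr∧x~y⇒y≤ys (≤-trans xl≤x x≤xr) (proj₁ (xl-left _ ysn≡))))

        low-dominator : ∀ {DX DY} → IsVED adj Everywhere Everywhere DX DY →
          (∃ λ x → x ∈ DX × x < xl) ⊎ (∃ λ y → y ∈ DY × y ≤ ys × zero ~ y)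
        low-dominator (_ , _ , dom) with dom zero zero tt tt (x≤xr⇒x~0 {zero} z≤n)
        ... | endpoint-x x₀∈              = inj₁ (zero , x₀∈ , x≤xr⇒x<xl {zero} z≤n)
        ... | endpoint-y y₀∈              = inj₂ (zero , y₀∈ , z≤n , x≤xr⇒x~0 {zero} z≤n)
        ... | neighbour-of-x y' y'∈ _ x₀~y' = inj₂ (y' , y'∈ , x≤xr∧x~y⇒y≤ys {zero} z≤n x₀~y' , x₀~y')
        ... | neighbour-of-y x' x'∈ _ x'~y₀ = inj₁ (x' , x'∈ , x≤xr⇒x<xl (proj₂ xr-right x' x'~y₀))

        -- Vertices y ≤ ys of D only matter to G′ through edges xy with y > ys, whose endpoint x is
        -- then also adjacent to y_{s+1} by convexity.
        restrict : ∀ {DX DY} → IsVED adj Everywhere Everywhere DX DY → ∀ {FY} →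
          (∀ y → y ∈ FY → ys < y) → (∀ {y} → y ∈ DY → ys < y → y ∈ FY) →
          (∀ {y} → y ∈ DY → y ≤ ys → ysn ∈ FY) → IsVED adj (xl ≤_) (ys <_) (DX ∩ atLeast xl) FY
        restrict {DX} {DY} (_ , _ , dom) {FY} FY-high DY⁺⊆FY low⇒ysn∈ =
          (λ _ x∈ → ∈-select⁻ (xl ≤?_) (proj₂ (x∈p∩q⁻ DX _ x∈))) , FY-high , dom′
          where
          dom′ : ∀ x y → xl ≤ x → ys < y → x ~ y → Dominated adj (xl ≤_) (ys <_) (DX ∩ atLeast xl) FY x y
          dom′ x y xl≤x ys<y x~y with dom x y tt tt x~y
          ... | endpoint-x x∈ = endpoint-x (x∈p∩q⁺ (x∈ , ∈-select⁺ (xl ≤?_) xl≤x))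
          ... | endpoint-y y∈ = endpoint-y (DY⁺⊆FY y∈ ys<y)
          ... | neighbour-of-y x' x'∈ _ x'~y =
            let xl≤x' = succ-leftY-bound xl-left ys<y x'~y
            in neighbour-of-y x' (x∈p∩q⁺ (x'∈ , ∈-select⁺ (xl ≤?_) xl≤x')) xl≤x' x'~y
          ... | neighbour-of-x y' y'∈ _ x~y' with y' ≤? ys
          ...   | no y'≰ys = neighbour-of-x y' (DY⁺⊆FY y'∈ (≰⇒> y'≰ys)) (≰⇒> y'≰ys) x~y'
          ...   | yes y'≤ys = neighbour-of-x ysn (low⇒ysn∈ y'∈ y'≤ys) ys<ysn
                    (convex x y' ysn y (≤-trans y'≤ys (<⇒≤ ys<ysn)) (ys<y⇒ysn≤y ys<y) x~y' x~y)

        restrict-raise : ∀ {DX DY} → IsVED adj Everywhere Everywhere DX DY →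
          IsVED adj (xl ≤_) (ys <_) (DX ∩ atLeast xl) ((DY ∩ above ys) ∪ ⁅ ysn ⁆)
        restrict-raise {DY = DY} vD =
          restrict vD high (λ y∈ ys<y → x∈p∪q⁺ (inj₁ (x∈p∩q⁺ (y∈ , ∈-select⁺ (ys <?_) ys<y))))
                           (λ _ _ → x∈p∪q⁺ (inj₂ (x∈⁅x⁆ ysn)))
          where
          high : ∀ y → y ∈ (DY ∩ above ys) ∪ ⁅ ysn ⁆ → ys < y
          high y y∈ with x∈p∪q⁻ (DY ∩ above ys) ⁅ ysn ⁆ y∈
          ... | inj₁ y∈⁺ = ∈-select⁻ (ys <?_) (proj₂ (x∈p∩q⁻ DY _ y∈⁺))
          ... | inj₂ y∈⁅ysn⁆ rewrite x∈⁅y⁆⇒x≡y ysn y∈⁅ysn⁆ = ys<ysn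

        restrict-high : ∀ {DX DY} → IsVED adj Everywhere Everywhere DX DY → (∀ {y} → y ∈ DY → ys < y) →
          IsVED adj (xl ≤_) (ys <_) (DX ∩ atLeast xl) (DY ∩ above ys)
        restrict-high {DY = DY} vD DY-high =
          restrict vD (λ _ y∈ → ∈-select⁻ (ys <?_) (proj₂ (x∈p∩q⁻ DY _ y∈)))
                      (λ y∈ ys<y → x∈p∩q⁺ (y∈ , ∈-select⁺ (ys <?_) ys<y))
                      (λ y∈ y≤ys → ⊥-elim (<⇒≱ (DY-high y∈) y≤ys))

        drop-low-x : ∀ {DX DY x} → IsVED adj Everywhere Everywhere DX DY → x ∈ DX → x < xl →
                     HasVED adj (xl ≤_) (ys <_) (ℕ._< ∣ DX ∣ + ∣ DY ∣)
        drop-low-x {DX} {DY} vD x∈ x<xl with any? (λ y → (y ∈? DY) ×-dec (y ≤? ys))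
        ... | yes (y , y∈ , y≤ys) =
          _ , _ , restrict-raise vD ,
          +-mono-≤ (∣p∩q∣<∣p∣ x∈ (∉atLeast x<xl))
                   (≤-trans (∣p∪⁅x⁆∣≤1+∣p∣ (DY ∩ above ys) ysn) (∣p∩q∣<∣p∣ y∈ (∉above y≤ys)))
        ... | no no-low-y =
          _ , _ , restrict-high vD (λ y∈ → ≰⇒> λ y≤ys → no-low-y (_ , y∈ , y≤ys)) ,
          +-mono-≤ (∣p∩q∣<∣p∣ x∈ (∉atLeast x<xl)) (∣p∩q∣≤∣p∣ DY _)

        drop-two-low-y : ∀ {DX DY y₁ y₂} → IsVED adj Everywhere Everywhere DX DY →
          y₁ ∈ DY → y₁ ≤ ys → y₂ ∈ DY → y₂ ≤ ys → y₂ ≢ y₁ →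
          HasVED adj (xl ≤_) (ys <_) (ℕ._< ∣ DX ∣ + ∣ DY ∣)
        drop-two-low-y {DX} {DY} vD y₁∈ y₁≤ys y₂∈ y₂≤ys y₂≢y₁ =
          _ , _ , restrict-raise vD ,
          +-mono-≤-< (∣p∩q∣≤∣p∣ DX _)
                     (≤-trans (s≤s (∣p∪⁅x⁆∣≤1+∣p∣ (DY ∩ above ys) ysn))
                              (∣p∩q∣+2≤∣p∣ y₁∈ y₂∈ y₂≢y₁ (∉above y₁≤ys) (∉above y₂≤ys)))

        module _ {DX DY} (vD : IsVED adj Everywhere Everywhere DX DY)
                 (DX-high : ∀ {x} → x ∈ DX → xl ≤ x)
                 {y₁} (y₁∈ : y₁ ∈ DY) (y₁≤ys : y₁ ≤ ys) (x₀~y₁ : zero ~ y₁)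
                 (only-y₁ : ∀ {y} → y ∈ DY → y ≤ ys → y ≡ y₁) where

          -- The farthest-reaching neighbour h of y₁ takes over the roles of both xₑ and y₁.
          exchange : ∀ {xₑ} → xₑ ∈ DX → left xₑ ≤ y₁ →
                     HasVED adj (xl ≤_) (ys <_) (ℕ._< ∣ DX ∣ + ∣ DY ∣)
          exchange {xₑ} xₑ∈ lxₑ≤y₁ with farthest-neighbour x₀~y₁
          ... | h , _ , h-reaches =
            FX , DY ∩ above ys , (FX-high , FY-high , dom′) ,
            +-mono-≤-< ∣FX∣≤∣DX∣ (∣p∩q∣<∣p∣ y₁∈ (∉above y₁≤ys))
            where
            FX : Subset (suc n₁)
            FX = ((DX - xₑ) ∪ ⁅ h ⁆) ∩ atLeast xl

            FX-high : ∀ x → x ∈ FX → xl ≤ x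
            FX-high _ x∈ = ∈-select⁻ (xl ≤?_) (proj₂ (x∈p∩q⁻ _ _ x∈))

            FY-high : ∀ y → y ∈ DY ∩ above ys → ys < y
            FY-high _ y∈ = ∈-select⁻ (ys <?_) (proj₂ (x∈p∩q⁻ DY _ y∈))

            ∣FX∣≤∣DX∣ : ∣ FX ∣ ℕ.≤ ∣ DX ∣
            ∣FX∣≤∣DX∣ = ≤-trans (∣p∩q∣≤∣p∣ ((DX - xₑ) ∪ ⁅ h ⁆) (atLeast xl))
                                (≤-trans (∣p∪⁅x⁆∣≤1+∣p∣ (DX - xₑ) h) (x∈p⇒∣p-x∣<∣p∣ xₑ∈))

            kept : ∀ {x} → x ∈ DX → x ≢ xₑ → x ∈ FX
            kept x∈ x≢xₑ =
              x∈p∩q⁺ (x∈p∪q⁺ (inj₁ (x∈p∧x≢y⇒x∈p-y x∈ x≢xₑ)) , ∈-select⁺ (xl ≤?_) (DX-high x∈))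

            xₑ~y⇒xₑ~y₁ : ∀ {y} → ys < y → xₑ ~ y → xₑ ~ y₁
            xₑ~y⇒xₑ~y₁ ys<y xₑ~y =
              convex xₑ (left xₑ) y₁ _ lxₑ≤y₁ (≤-trans y₁≤ys (<⇒≤ ys<y)) (left-adj xₑ) xₑ~y

            by-h : ∀ {x y z} → ys < y → z ~ y₁ → z ~ y →
                   Dominated adj (xl ≤_) (ys <_) FX (DY ∩ above ys) x y
            by-h ys<y z~y₁ z~y =
              let h~y = h-reaches z~y₁ z~y (≤-trans y₁≤ys (<⇒≤ ys<y))
                  xl≤h = succ-leftY-bound xl-left ys<y h~y
              in neighbour-of-y h (x∈p∩q⁺ (x∈p∪q⁺ (inj₂ (x∈⁅x⁆ h)) , ∈-select⁺ (xl ≤?_) xl≤h)) xl≤h h~y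

            dom′ : ∀ x y → xl ≤ x → ys < y → x ~ y →
                   Dominated adj (xl ≤_) (ys <_) FX (DY ∩ above ys) x y
            dom′ x y _ ys<y x~y with proj₂ (proj₂ vD) x y tt tt x~y
            ... | endpoint-x x∈ with x ≟ xₑ
            ...   | yes refl = by-h ys<y (xₑ~y⇒xₑ~y₁ ys<y x~y) x~y
            ...   | no x≢xₑ = endpoint-x (kept x∈ x≢xₑ)
            dom′ x y _ ys<y x~y | endpoint-y y∈ = endpoint-y (x∈p∩q⁺ (y∈ , ∈-select⁺ (ys <?_) ys<y))
            dom′ x y _ ys<y x~y | neighbour-of-x y' y'∈ _ x~y' with y' ≤? ys
            ... | yes y'≤ys = by-h ys<y (subst (x ~_) (only-y₁ y'∈ y'≤ys) x~y') x~y
            ... | no y'≰ys =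
              neighbour-of-x y' (x∈p∩q⁺ (y'∈ , ∈-select⁺ (ys <?_) (≰⇒> y'≰ys))) (≰⇒> y'≰ys) x~y'
            dom′ x y _ ys<y x~y | neighbour-of-y x' x'∈ _ x'~y with x' ≟ xₑ
            ... | yes refl = by-h ys<y (xₑ~y⇒xₑ~y₁ ys<y x'~y) x'~y
            ... | no x'≢xₑ = neighbour-of-y x' (kept x'∈ x'≢xₑ) (DX-high x'∈) x'~y

          module _ (high : ∀ {x} → x ∈ DX → y₁ < left x) {kα} (kα-right : IsRightY adj y₁ kα) where

            x≤kα⇒left≤y₁ : ∀ {x} → x ≤ kα → left x ≤ y₁
            x≤kα⇒left≤y₁ x≤kα = ≤-trans (left-mono x≤kα) (left-min (proj₁ kα-right))

            DX-beyond : ∀ x → x ∈ DX → kα < x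
            DX-beyond _ x∈ = ≰⇒> λ x≤kα → <⇒≱ (high x∈) (x≤kα⇒left≤y₁ x≤kα)

            -- D has to dominate the edge from x to left(x).
            x≤kα⇒x~y₁ : ∀ {x} → x ≤ kα → x ~ y₁
            x≤kα⇒x~y₁ {x} x≤kα with proj₂ (proj₂ vD) x (left x) tt tt (left-adj x)
            ... | endpoint-x x∈ = ⊥-elim (<⇒≱ (high x∈) (x≤kα⇒left≤y₁ x≤kα))
            ... | endpoint-y lx∈ =
              subst (x ~_) (only-y₁ lx∈ (≤-trans (x≤kα⇒left≤y₁ x≤kα) y₁≤ys)) (left-adj x)
            ... | neighbour-of-y x' x'∈ _ x'~lx =
              ⊥-elim (<⇒≱ (high x'∈) (≤-trans (left-min x'~lx) (x≤kα⇒left≤y₁ x≤kα)))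
            ... | neighbour-of-x y' y'∈ _ x~y' with y₁ ≤? y'
            ...   | yes y₁≤y' = convex x (left x) y₁ y' (x≤kα⇒left≤y₁ x≤kα) y₁≤y' (left-adj x) x~y'
            ...   | no y₁≰y' = subst (x ~_) (only-y₁ y'∈ (≤-trans (<⇒≤ (≰⇒> y₁≰y')) y₁≤ys)) x~y'

            drop-y₁ : ∀ {lα} → IsLeftOfSuccX kα lα →
                      IsVED adj (kα <_) (lα ≤_) DX ((DY - y₁) ∩ atLeast lα)
            drop-y₁ {lα} lα-left =
              DX-beyond , (λ _ y∈ → ∈-select⁻ (lα ≤?_) (proj₂ (x∈p∩q⁻ _ _ y∈))) , dom′
              where
              kept : ∀ {x y} → y ∈ DY → kα < x → x ~ y → lα ≤ y → y ∈ (DY - y₁) ∩ atLeast lα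
              kept y∈ kα<x x~y lα≤y =
                x∈p∩q⁺ (x∈p∧x≢y⇒x∈p-y y∈ (λ { refl → <⇒≱ kα<x (proj₂ kα-right _ x~y) }) ,
                        ∈-select⁺ (lα ≤?_) lα≤y)

              dom′ : ∀ x y → kα < x → lα ≤ y → x ~ y →
                     Dominated adj (kα <_) (lα ≤_) DX ((DY - y₁) ∩ atLeast lα) x y
              dom′ x y kα<x lα≤y x~y with proj₂ (proj₂ vD) x y tt tt x~y
              ... | endpoint-x x∈ = endpoint-x x∈
              ... | endpoint-y y∈ = endpoint-y (kept y∈ kα<x x~y lα≤y)
              ... | neighbour-of-x y' y'∈ _ x~y' =
                let lα≤y' = succ-leftX-bound lα-left kα<x x~y'
                in neighbour-of-x y' (kept y'∈ kα<x x~y' lα≤y') lα≤y' x~y'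
              ... | neighbour-of-y x' x'∈ _ x'~y = neighbour-of-y x' x'∈ (DX-beyond _ x'∈) x'~y

          shift : (∀ {x} → x ∈ DX → y₁ < left x) → CaseB (∣ DX ∣ + ∣ DY ∣)
          shift high with ∃-greatest (_~? y₁) (zero , x₀~y₁)
          ... | kα , kα-right with succ-leftX-exists kα
          ... | lα , lα-left =
            y₁ , kα , lα , x₀~y₁ , kα-right , lα-left , x≤kα⇒x~y₁ high kα-right ,
            DX , _ , drop-y₁ high kα-right lα-left ,
            +-mono-≤-< ≤-refl (≤-trans (s≤s (∣p∩q∣≤∣p∣ (DY - y₁) _)) (x∈p⇒∣p-x∣<∣p∣ y₁∈))

          exchange-or-shift :
            HasVED adj (xl ≤_) (ys <_) (ℕ._< ∣ DX ∣ + ∣ DY ∣) ⊎ CaseB (∣ DX ∣ + ∣ DY ∣)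
          exchange-or-shift with any? (λ x → (x ∈? DX) ×-dec (left x ≤? y₁))
          ... | yes (_ , xₑ∈ , lxₑ≤y₁) = inj₁ (exchange xₑ∈ lxₑ≤y₁)
          ... | no none = inj₂ (shift λ x∈ → ≰⇒> λ l≤y₁ → none (_ , x∈ , l≤y₁))

        shrink : ∀ {g} → GammaVE adj Everywhere Everywhere g →
                 HasVED adj (xl ≤_) (ys <_) (ℕ._< g) ⊎ CaseB g
        shrink ((DX , DY , vD , refl) , _) with any? (λ x → (x ∈? DX) ×-dec (x <? xl))
        ... | yes (_ , x∈ , x<xl) = inj₁ (drop-low-x vD x∈ x<xl)
        ... | no no-low-x with low-dominator vD
        ...   | inj₁ low-x = ⊥-elim (no-low-x low-x)
        ...   | inj₂ (y₁ , y₁∈ , y₁≤ys , x₀~y₁)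
                with any? (λ y → (y ∈? DY) ×-dec (y ≤? ys) ×-dec ¬? (y ≟ y₁))
        ...     | yes (_ , y₂∈ , y₂≤ys , y₂≢y₁) = inj₁ (drop-two-low-y vD y₁∈ y₁≤ys y₂∈ y₂≤ys y₂≢y₁)
        ...     | no no-other = exchange-or-shift vD DX-high y₁∈ y₁≤ys x₀~y₁ only-y₁
          where
          DX-high : ∀ {x} → x ∈ DX → xl ≤ x
          DX-high x∈ = ≮⇒≥ λ x<xl → no-low-x (_ , x∈ , x<xl)
          only-y₁ : ∀ {y} → y ∈ DY → y ≤ ys → y ≡ y₁
          only-y₁ y∈ y≤ys = decidable-stable (_ ≟ y₁) λ y≢y₁ → no-other (_ , y∈ , y≤ys , y≢y₁)

lemma3 : ∀ {n₁ n₂ : ℕ} (adj : Fin (suc n₁) → Fin (suc n₂) → Bool) →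
  Connected adj → LexConvex adj →
  ∀ (xr : Fin (suc n₁)) (ys : Fin (suc n₂)) (xl : Fin (suc n₁)) →
  IsRightY adj zero xr → IsRightX adj xr ys →
  (∀ y' → toℕ y' ≡ suc (toℕ ys) → IsLeftY adj y' xl) →
  GammaPlusOne adj (λ _ → ⊤) (λ _ → ⊤) (λ x → xl ≤ x) (λ y → ys < y)
  ⊎ (∃[ yα ] ∃[ kα ] ∃[ lα ]
      (adj zero yα ≡ true × IsRightY adj yα kα ×
       (∀ x' → toℕ x' ≡ suc (toℕ kα) → IsLeftX adj x' lα) ×
       GammaPlusOne adj (λ _ → ⊤) (λ _ → ⊤) (λ x → kα < x) (λ y → lα ≤ y)))
lemma3 adj connected lex-convex xr ys xl xr-right ys-right xl-left
  with γve-exists adj {Everywhere} {Everywhere} (λ _ → yes tt) (λ _ → yes tt)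
... | _ , γG = case next-or-last ys of λ where
      (inj₂ ys-last) →
        inj₁ (γve+1-intro adj (xl ≤?_) (ys <?_) (extend-G′ xl-left) γG (G′-empty ys-last γG))
      (inj₁ (_ , ysn≡)) → case shrink xl-left ysn≡ γG of λ where
        (inj₁ G′-below) → inj₁ (γve+1-intro adj (xl ≤?_) (ys <?_) (extend-G′ xl-left) γG G′-below)
        (inj₂ (yα , kα , lα , x₀~yα , kα-right , lα-left , covers , G̃-below)) →
          inj₂ (yα , kα , lα , x₀~yα , kα-right , lα-left ,
                γve+1-intro adj (kα <?_) (lα ≤?_) (extend-G̃ lα-left covers) γG G̃-below)
  where
  open LexConvexGraph adj connected lex-convex
  open FirstBlock xr ys xr-right ys-right
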